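{- Let $f$ be a procedure enumerating a finite set $A=\{a_1,a_2,\dots\}$ of objects and let $D_f(\mathrm{size}(s))$ denote the delay time of $f$ to emit the object $s$. If $D_f$ is linear (i.e., $D_f(\mathrm{size}(s))=O(\mathrm{size}(s))$), then the output delay time complexity of $\textsc{EnumerateMultisets}(f,k,u)$ is linear, i.e., each emitted multiset $S$ is emitted within $O(\mathrm{size}(S))$ time after the previous emission (or the start).
   Context: $\textsc{EnumerateMultisets}(f,k,u)$ enumerates all multisets of exactly $k$ elements chosen from the first $u$ elements of $A$: if $k=0$, it yields $\emptyset$ and returns; otherwise it sets $i\gets0$ and, for each item among the first (at most) $u$ elements emitted by $f$ (a bound check costing constant time), it sets $i\gets i+1$ and for each multiset $S$ yielded by $\textsc{EnumerateMultisets}(f,k-1,i)$ yields $S\uplus\{\text{item}\}$. The size of an object is the number of bits of its representation; the size of a multiset $\{s_1,\dots,s_k\}$ is $\sum_j\mathrm{size}(s_j)$. The delay of an enumeration procedure is the time between two consecutive emissions (and until the first emission). -}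

module Defs where

open import Data.Nat using (ℕ; zero; suc; _+_)
open import Data.List using (List; []; _∷_; _++_; map)
open import Data.Nat.ListAction using (sum)
open import Data.Product using (_×_; _,_)

-- An enumeration procedure f for a finite set A = {a₁, a₂, …} is modelled by
-- its run: the list of its emissions in order, each paired with its delay
-- (the time spent since the previous emission, or since the start).
Enumerator : Set → Set
Enumerator A = List (ℕ × A)

-- A multiset of objects is represented by a list (order is irrelevant).
Multiset : Set → Set
Multiset A = List A

msize : {A : Set} → (A → ℕ) → Multiset A → ℕ
msize size S = sum (map size S)

-- Execution trace of a procedure: elapsed time or an emission.
data Event (A : Set) : Set where
  tick : ℕ → Event A
  out  : Multiset A → Event A

-- S ⊎ {item}: every yielded multiset S of the recursive call is turned into
-- S ⊎ {item} (one unit of time), elapsed time is kept.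
addItem : {A : Set} → A → List (Event A) → List (Event A)
addItem a []             = []
addItem a (tick n ∷ es)  = tick n ∷ addItem a es
addItem a (out S ∷ es)   = tick 1 ∷ out (a ∷ S) ∷ addItem a es

-- Trace of EnumerateMultisets(f, k, u) in a unit-cost model: every primitive
-- step (test of k, assignment, bound check, call, ⊎) costs one unit, and
-- obtaining the next item from (a fresh run of) f costs f's delay.
enumerateMultisets : {A : Set} → Enumerator A → ℕ → ℕ → List (Event A)
enumerateMultisets f zero    u = tick 1 ∷ out [] ∷ []
enumerateMultisets f (suc k) u = tick 1 ∷ loop f 0 u
  where
  -- loop over the items of f; i = items seen so far, r = remaining bound
  loop : Enumerator _ → ℕ → ℕ → List (Event _)
  loop xs             i zero    = tick 1 ∷ []
  loop []             i (suc r) = tick 1 ∷ []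
  loop ((d , a) ∷ xs) i (suc r) =
    tick 1 ∷ tick d ∷ tick 1 ∷ tick 1 ∷
    addItem a (enumerateMultisets f k (suc i)) ++ loop xs (suc i) r

delaysFrom : {A : Set} → ℕ → List (Event A) → List (ℕ × Multiset A)
delaysFrom acc []            = []
delaysFrom acc (tick n ∷ es) = delaysFrom (acc + n) es
delaysFrom acc (out S ∷ es)  = (acc , S) ∷ delaysFrom 0 es

delays : {A : Set} → List (Event A) → List (ℕ × Multiset A)
delays = delaysFrom 0

{-# OPTIONS --safe #-}
module Submission where

-- Every multiset emitted by EnumerateMultisets(f, k, ·) has k elements, so its
-- size m is at least k. By induction on k, the first emission comes at most
-- 5k + 1 + c·m after the start, every later one at most 6k + c·m after its
-- predecessor, and at most k time passes between the last emission and the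
-- end. A later emission is either a later emission of the current recursive
-- call, delayed by one more unit for ⊎, or the first emission of the next
-- call; the latter is preceded by the idle tail (≤ k) of the previous call and
-- by fetching the next item, whose delay c·size(item) is paid for by that
-- item's share of m. Hence every delay is at most 6k + 1 + c·m ≤ (6 + c)(m + 1).

open import Defs
open import Data.Nat using (ℕ; zero; suc; _+_; _*_; _≤_; z≤n; s≤s)
open import Data.Nat.Properties
  using (≤-trans; n≤1+n; m≤m+n; +-comm; +-monoˡ-≤; +-monoʳ-≤; +-mono-≤; *-monoˡ-≤; *-monoʳ-≤; module ≤-Reasoning)
open import Data.Nat.Tactic.RingSolver using (solve)
open import Data.List using (List; []; _∷_; _++_; map; length)
import Data.List as L
open import Data.List.Relation.Unary.All using (All; []; _∷_)
import Data.List.Relation.Unary.All as All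
open import Data.List.Relation.Unary.All.Properties using (++⁺; map⁺)
open import Data.Product using (_×_; _,_; proj₁; proj₂; ∃-syntax)
open import Function using (_∘_)
open import Relation.Binary.PropositionalEquality using (_≡_; refl; cong; subst; sym)

block : {A : Set} → Enumerator A → ℕ → ℕ → A → ℕ → List (Event A)
block f k d a i = tick 1 ∷ tick d ∷ tick 1 ∷ tick 1 ∷ addItem a (enumerateMultisets f k (suc i))

-- The loop of enumerateMultisets lives in an anonymous where block, so it has
-- no name; `loop f k u` is that function (its first arguments are the variables
-- of the defining clause). It is found by unification: once every argument of
-- its occurrence in the goal of enumerateMultisets-cons is generalised by
-- `with`, refl poses a pattern unification problem whose only solution is it.
mutual
  loop : {A : Set} → Enumerator A → ℕ → ℕ → Enumerator A → ℕ → ℕ → List (Event A)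
  loop = _

  enumerateMultisets-cons : {A : Set} (d : ℕ) (a : A) (xs : Enumerator A) (k r : ℕ) →
    enumerateMultisets ((d , a) ∷ xs) (suc k) (suc r) ≡
    tick 1 ∷ block ((d , a) ∷ xs) k d a 0 ++ loop ((d , a) ∷ xs) k (suc r) xs 1 r
  enumerateMultisets-cons d a xs k r with (d , a) ∷ xs | suc r
  ... | f | u with xs | 1 | r
  ... | ys | i | s = refl

idleFrom : {A : Set} → ℕ → List (Event A) → ℕ
idleFrom acc []            = acc
idleFrom acc (tick n ∷ es) = idleFrom (acc + n) es
idleFrom acc (out S ∷ es)  = idleFrom 0 es

delaysFrom-++ : {A : Set} (acc : ℕ) (T R : List (Event A)) →
  delaysFrom acc (T ++ R) ≡ delaysFrom acc T ++ delaysFrom (idleFrom acc T) R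
delaysFrom-++ acc []           R = refl
delaysFrom-++ acc (tick n ∷ T) R = delaysFrom-++ (acc + n) T R
delaysFrom-++ acc (out S ∷ T)  R = cong ((acc , S) ∷_) (delaysFrom-++ 0 T R)

idleFrom-++ : {A : Set} (acc : ℕ) (T R : List (Event A)) →
  idleFrom acc (T ++ R) ≡ idleFrom (idleFrom acc T) R
idleFrom-++ acc []           R = refl
idleFrom-++ acc (tick n ∷ T) R = idleFrom-++ (acc + n) T R
idleFrom-++ acc (out S ∷ T)  R = idleFrom-++ 0 T R

addToEmission : {A : Set} → A → ℕ × Multiset A → ℕ × Multiset A
addToEmission a (t , S) = (t + 1 , a ∷ S)

delaysFrom-addItem : {A : Set} (a : A) (acc : ℕ) (T : List (Event A)) →
  delaysFrom acc (addItem a T) ≡ map (addToEmission a) (delaysFrom acc T)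
delaysFrom-addItem a acc []           = refl
delaysFrom-addItem a acc (tick n ∷ T) = delaysFrom-addItem a (acc + n) T
delaysFrom-addItem a acc (out S ∷ T)  = cong ((acc + 1 , a ∷ S) ∷_) (delaysFrom-addItem a 0 T)

idleFrom-addItem : {A : Set} (a : A) (acc : ℕ) (T : List (Event A)) →
  idleFrom acc (addItem a T) ≡ idleFrom acc T
idleFrom-addItem a acc []           = refl
idleFrom-addItem a acc (tick n ∷ T) = idleFrom-addItem a (acc + n) T
idleFrom-addItem a acc (out S ∷ T)  = idleFrom-addItem a 0 T

All-delaysFrom-++ : {A : Set} {P : ℕ × Multiset A → Set} (acc : ℕ) (T R : List (Event A)) →
  All P (delaysFrom acc T) → All P (delaysFrom (idleFrom acc T) R) → All P (delaysFrom acc (T ++ R))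
All-delaysFrom-++ {P = P} acc T R p q = subst (All P) (sym (delaysFrom-++ acc T R)) (++⁺ p q)

data Headed {X : Set} (P Q : X → Set) : List X → Set where
  _∷_ : ∀ {x xs} → P x → All Q xs → Headed P Q (x ∷ xs)

module _ {X : Set} {P Q : X → Set} where

  Headed-++⁺ : ∀ {xs ys} → Headed P Q xs → All Q ys → Headed P Q (xs ++ ys)
  Headed-++⁺ (p ∷ qs) qs′ = p ∷ ++⁺ qs qs′

  Headed-map : {P′ Q′ : X → Set} → (∀ x → P x → P′ x) → (∀ x → Q x → Q′ x) →
    ∀ {xs} → Headed P Q xs → Headed P′ Q′ xs
  Headed-map g h (p ∷ qs) = g _ p ∷ All.map (h _) qs

  Headed⇒All : {R : X → Set} → (∀ x → P x → R x) → (∀ x → Q x → R x) →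
    ∀ {xs} → Headed P Q xs → All R xs
  Headed⇒All g h (p ∷ qs) = g _ p ∷ All.map (h _) qs

Headed-map⁺ : {X Y : Set} {P Q : Y → Set} (g : X → Y) {xs : List X} →
  Headed (P ∘ g) (Q ∘ g) xs → Headed P Q (map g xs)
Headed-map⁺ g (p ∷ qs) = p ∷ map⁺ qs

Headed-delaysFrom-++ : {A : Set} {P Q : ℕ × Multiset A → Set} (acc : ℕ) (T R : List (Event A)) →
  Headed P Q (delaysFrom acc T) → All Q (delaysFrom (idleFrom acc T) R) →
  Headed P Q (delaysFrom acc (T ++ R))
Headed-delaysFrom-++ {P = P} {Q} acc T R p q =
  subst (Headed P Q) (sym (delaysFrom-++ acc T R)) (Headed-++⁺ p q)

All-delaysFrom-addItem : {A : Set} {P : ℕ × Multiset A → Set} (a : A) (acc : ℕ) (T : List (Event A)) →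
  All (P ∘ addToEmission a) (delaysFrom acc T) → All P (delaysFrom acc (addItem a T))
All-delaysFrom-addItem {P = P} a acc T p =
  subst (All P) (sym (delaysFrom-addItem a acc T)) (map⁺ p)

Headed-delaysFrom-addItem : {A : Set} {P Q : ℕ × Multiset A → Set} (a : A) (acc : ℕ) (T : List (Event A)) →
  Headed (P ∘ addToEmission a) (Q ∘ addToEmission a) (delaysFrom acc T) →
  Headed P Q (delaysFrom acc (addItem a T))
Headed-delaysFrom-addItem {P = P} {Q} a acc T p =
  subst (Headed P Q) (sym (delaysFrom-addItem a acc T)) (Headed-map⁺ (addToEmission a) p)

emitted-length : {A : Set} (f : Enumerator A) (k u acc : ℕ) →
  All (λ e → length (proj₂ e) ≡ k) (delaysFrom acc (enumerateMultisets f k u))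
emitted-length f zero    u acc = refl ∷ []
emitted-length f (suc k) u acc = loop-length f 0 u (acc + 1)
  where
  loop-length : ∀ xs i r acc →
    All (λ e → length (proj₂ e) ≡ suc k) (delaysFrom acc (loop f k u xs i r))
  loop-length xs             i zero    acc = []
  loop-length []             i (suc r) acc = []
  loop-length ((d , a) ∷ xs) i (suc r) acc =
    All-delaysFrom-++ acc (block f k d a i) (loop f k u xs (suc i) r)
      (All-delaysFrom-addItem a _ (enumerateMultisets f k (suc i))
        (All.map (cong suc) (emitted-length f k (suc i) _)))
      (loop-length xs (suc i) r _)

length≤msize : {A : Set} (size : A → ℕ) → (∀ a → 1 ≤ size a) → (S : Multiset A) →
  length S ≤ msize size S
length≤msize size size≥1 []      = z≤n
length≤msize size size≥1 (a ∷ S) = +-mono-≤ (size≥1 a) (length≤msize size size≥1 S)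

module DelayBounds {A : Set} (size : A → ℕ) (c : ℕ) where

  LinearDelays : Enumerator A → Set
  LinearDelays = All (λ p → proj₁ p ≤ c * size (proj₂ p))

  firstBound restBound : ℕ → ℕ → ℕ
  firstBound k m = 5 * k + 1 + c * m
  restBound  k m = 6 * k + c * m

  FirstWithin : ℕ → ℕ → ℕ × Multiset A → Set
  FirstWithin k acc (t , S) = t ≤ acc + firstBound k (msize size S)

  RestWithin : ℕ → ℕ × Multiset A → Set
  RestWithin k (t , S) = t ≤ restBound k (msize size S)

  open ≤-Reasoning

  first-addToEmission : ∀ {k acc d} a → d ≤ c * size a →
    ∀ e → FirstWithin k (acc + 1 + d + 1 + 1) e → FirstWithin k (acc + 4) (addToEmission a e)
  first-addToEmission {k} {acc} {d} a d≤ (t , S) = bound (size a) (msize size S) d≤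
    where
    bound : ∀ s m → d ≤ c * s → t ≤ acc + 1 + d + 1 + 1 + firstBound k m →
      t + 1 ≤ acc + 4 + firstBound k (s + m)
    bound s m d≤ t≤ = begin
      t + 1                                          ≤⟨ +-monoˡ-≤ 1 t≤ ⟩
      acc + 1 + d + 1 + 1 + (5 * k + 1 + c * m) + 1  ≡⟨ solve (acc L.∷ d L.∷ k L.∷ m L.∷ c L.∷ L.[]) ⟩
      acc + 4 + (5 * k + 1 + c * m) + d              ≤⟨ +-monoʳ-≤ (acc + 4 + (5 * k + 1 + c * m)) d≤ ⟩
      acc + 4 + (5 * k + 1 + c * m) + c * s          ≡⟨ solve (acc L.∷ k L.∷ m L.∷ s L.∷ c L.∷ L.[]) ⟩
      acc + 4 + (5 * k + 1 + c * (s + m))            ∎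

  rest-addToEmission : ∀ {k} a → ∀ e → RestWithin k e → RestWithin (suc k) (addToEmission a e)
  rest-addToEmission {k} a (t , S) = bound (size a) (msize size S)
    where
    bound : ∀ s m → t ≤ restBound k m → t + 1 ≤ restBound (suc k) (s + m)
    bound s m t≤ = begin
      t + 1                           ≤⟨ +-monoˡ-≤ 1 t≤ ⟩
      6 * k + c * m + 1               ≤⟨ m≤m+n (6 * k + c * m + 1) (5 + c * s) ⟩
      6 * k + c * m + 1 + (5 + c * s) ≡⟨ solve (k L.∷ m L.∷ s L.∷ c L.∷ L.[]) ⟩
      6 * suc k + c * (s + m)         ∎

  first-suc : ∀ {k acc} e → FirstWithin k (acc + 1 + 4) e → FirstWithin (suc k) acc e
  first-suc {k} {acc} (t , S) = bound (msize size S)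
    where
    bound : ∀ m → t ≤ acc + 1 + 4 + firstBound k m → t ≤ acc + firstBound (suc k) m
    bound m t≤ = begin
      t                                  ≤⟨ t≤ ⟩
      acc + 1 + 4 + (5 * k + 1 + c * m)  ≡⟨ solve (acc L.∷ k L.∷ m L.∷ c L.∷ L.[]) ⟩
      acc + (5 * suc k + 1 + c * m)      ∎

  first⇒rest : ∀ {k acc} → acc ≤ k → ∀ e → FirstWithin k (acc + 4) e → RestWithin (suc k) e
  first⇒rest {k} {acc} acc≤k (t , S) = bound (msize size S)
    where
    bound : ∀ m → t ≤ acc + 4 + firstBound k m → t ≤ restBound (suc k) m
    bound m t≤ = begin
      t                                ≤⟨ t≤ ⟩
      acc + 4 + (5 * k + 1 + c * m)    ≤⟨ +-monoˡ-≤ (5 * k + 1 + c * m) (+-monoˡ-≤ 4 acc≤k) ⟩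
      k + 4 + (5 * k + 1 + c * m)      ≤⟨ m≤m+n (k + 4 + (5 * k + 1 + c * m)) 1 ⟩
      k + 4 + (5 * k + 1 + c * m) + 1  ≡⟨ solve (k L.∷ m L.∷ c L.∷ L.[]) ⟩
      6 * suc k + c * m                ∎

  record LevelBounds (f : Enumerator A) (k : ℕ) : Set where
    field
      delays-headed : ∀ i acc → Headed (FirstWithin k acc) (RestWithin k)
                                       (delaysFrom acc (enumerateMultisets f k (suc i)))
      idle≤ : ∀ i acc → idleFrom acc (enumerateMultisets f k (suc i)) ≤ k

  module Loop {f : Enumerator A} {k : ℕ} (bounds : LevelBounds f k) where
    open LevelBounds bounds

    block-delays : ∀ {d} a i acc → d ≤ c * size a →
      Headed (FirstWithin k (acc + 4)) (RestWithin (suc k)) (delaysFrom acc (block f k d a i))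
    block-delays {d} a i acc d≤ =
      Headed-delaysFrom-addItem a (acc + 1 + d + 1 + 1) (enumerateMultisets f k (suc i))
        (Headed-map (first-addToEmission {k} {acc} a d≤) (rest-addToEmission a)
          (delays-headed i (acc + 1 + d + 1 + 1)))

    block-idle : ∀ {d} a i acc → idleFrom acc (block f k d a i) ≤ k
    block-idle {d} a i acc =
      subst (_≤ k) (sym (idleFrom-addItem a (acc + 1 + d + 1 + 1) (enumerateMultisets f k (suc i))))
        (idle≤ i (acc + 1 + d + 1 + 1))

    loop-delays : ∀ u xs i r acc → acc ≤ k → LinearDelays xs →
      All (RestWithin (suc k)) (delaysFrom acc (loop f k u xs i r))
    loop-delays u xs             i zero    acc _     _          = []
    loop-delays u []             i (suc r) acc _     _          = []
    loop-delays u ((d , a) ∷ xs) i (suc r) acc acc≤k (d≤ ∷ lin) =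
      All-delaysFrom-++ acc (block f k d a i) (loop f k u xs (suc i) r)
        (Headed⇒All (first⇒rest acc≤k) (λ _ q → q) (block-delays a i acc d≤))
        (loop-delays u xs (suc i) r _ (block-idle a i acc) lin)

    loop-idle : ∀ u xs i r acc → acc ≤ k → idleFrom acc (loop f k u xs i r) ≤ suc k
    loop-idle u xs             i zero    acc acc≤k = subst (_≤ suc k) (+-comm 1 acc) (s≤s acc≤k)
    loop-idle u []             i (suc r) acc acc≤k = subst (_≤ suc k) (+-comm 1 acc) (s≤s acc≤k)
    loop-idle u ((d , a) ∷ xs) i (suc r) acc _     =
      subst (_≤ suc k) (sym (idleFrom-++ acc (block f k d a i) (loop f k u xs (suc i) r)))
        (loop-idle u xs (suc i) r _ (block-idle a i acc))

  levelBounds : ∀ {d a xs} → LinearDelays ((d , a) ∷ xs) → ∀ k → LevelBounds ((d , a) ∷ xs) k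
  levelBounds lin zero = record
    { delays-headed = λ i acc → +-monoʳ-≤ acc (s≤s z≤n) ∷ []
    ; idle≤         = λ i acc → z≤n
    }
  levelBounds {d} {a} {xs} lin@(d≤ ∷ lin-xs) (suc k) = record
    { delays-headed = delays-headed
    ; idle≤         = idle≤
    }
    where
    open Loop (levelBounds lin k)

    f : Enumerator A
    f = (d , a) ∷ xs

    delays-headed : ∀ i acc → Headed (FirstWithin (suc k) acc) (RestWithin (suc k))
                                     (delaysFrom acc (enumerateMultisets f (suc k) (suc i)))
    delays-headed i acc rewrite enumerateMultisets-cons d a xs k i =
      Headed-delaysFrom-++ (acc + 1) (block f k d a 0) (loop f k (suc i) xs 1 i)
        (Headed-map first-suc (λ _ q → q) (block-delays a 0 (acc + 1) d≤))
        (loop-delays (suc i) xs 1 i _ (block-idle a 0 (acc + 1)) lin-xs)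

    idle≤ : ∀ i acc → idleFrom acc (enumerateMultisets f (suc k) (suc i)) ≤ suc k
    idle≤ i acc rewrite enumerateMultisets-cons d a xs k i =
      subst (_≤ suc k) (sym (idleFrom-++ (acc + 1) (block f k d a 0) (loop f k (suc i) xs 1 i)))
        (loop-idle (suc i) xs 1 i _ (block-idle a 0 (acc + 1)))

  delays-within : (f : Enumerator A) → LinearDelays f → ∀ k u →
    All (λ e → proj₁ e ≤ 6 * k + 1 + c * msize size (proj₂ e)) (delays (enumerateMultisets f k u))
  delays-within f              lin zero    u       = s≤s z≤n ∷ []
  delays-within f              lin (suc k) zero    = []
  delays-within []             lin (suc k) (suc i) = []
  delays-within ((d , a) ∷ xs) lin (suc k) (suc i) =
    Headed⇒All first≤ rest≤ (LevelBounds.delays-headed (levelBounds lin (suc k)) i 0)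
    where
    first≤ : ∀ e → FirstWithin (suc k) 0 e → proj₁ e ≤ 6 * suc k + 1 + c * msize size (proj₂ e)
    first≤ (t , S) t≤ =
      ≤-trans t≤ (+-monoˡ-≤ (c * msize size S) (+-monoˡ-≤ 1 (*-monoˡ-≤ (suc k) (n≤1+n 5))))
    rest≤ : ∀ e → RestWithin (suc k) e → proj₁ e ≤ 6 * suc k + 1 + c * msize size (proj₂ e)
    rest≤ (t , S) t≤ =
      ≤-trans t≤ (+-monoˡ-≤ (c * msize size S) (m≤m+n (6 * suc k) 1))

  delay≤linear : ∀ k m t → k ≤ m → t ≤ 6 * k + 1 + c * m → t ≤ (6 + c) * suc m
  delay≤linear k m t k≤m t≤ = begin
    t                          ≤⟨ t≤ ⟩
    6 * k + 1 + c * m          ≤⟨ +-monoˡ-≤ (c * m) (+-monoˡ-≤ 1 (*-monoʳ-≤ 6 k≤m)) ⟩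
    6 * m + 1 + c * m          ≤⟨ m≤m+n (6 * m + 1 + c * m) (5 + c) ⟩
    6 * m + 1 + c * m + (5 + c) ≡⟨ solve (m L.∷ c L.∷ L.[]) ⟩
    (6 + c) * suc m            ∎

corollary1 : {A : Set} (size : A → ℕ) → (∀ a → 1 ≤ size a) → (c : ℕ) →
    ∃[ c′ ] ((f : Enumerator A) →
    All (λ p → proj₁ p ≤ c * size (proj₂ p)) f →
    (k u : ℕ) →
    All (λ p → proj₁ p ≤ c′ * suc (msize size (proj₂ p)))
    (delays (enumerateMultisets f k u)))
corollary1 {A} size size≥1 c = 6 + c , bounded
  where
  open DelayBounds size c
  bounded : (f : Enumerator A) → LinearDelays f → ∀ k u →
    All (λ e → proj₁ e ≤ (6 + c) * suc (msize size (proj₂ e))) (delays (enumerateMultisets f k u))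
  bounded f lin k u = All.zipWith (λ {e} → linear {e}) (delays-within f lin k u , emitted-length f k u 0)
    where
    linear : ∀ {e} → proj₁ e ≤ 6 * k + 1 + c * msize size (proj₂ e) × length (proj₂ e) ≡ k →
      proj₁ e ≤ (6 + c) * suc (msize size (proj₂ e))
    linear {t , S} (t≤ , length≡k) =
      delay≤linear k (msize size S) t (subst (_≤ msize size S) length≡k (length≤msize size size≥1 S)) t≤
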